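{- Let $p_0', p_0''$ be natural numbers with $p_0' < p_0''$, and let $(p_k')_{k\ge 0}$ and $(p_k'')_{k\ge 0}$ be the Eratosthenes progressions of bases $p_0'$ and $p_0''$, with rays $r_{p_0'}=\{p_k'\}_{k\ge1}$ and $r_{p_0''}=\{p_k''\}_{k\ge1}$. Then: (1) if $p_0'' \in r_{p_0'}$, then $r_{p_0''} \subset r_{p_0'}$; (2) if $p_0'' \notin r_{p_0'}$, then $r_{p_0''}\cap r_{p_0'}=\emptyset$, and moreover $p_k' < p_k''$ for all $k=0,1,2,\ldots$.
   Context: Let $p_1=2<p_2=3<p_3=5<\dots$ be the primes in increasing order, and for a natural number $n$ let $\pi^{ -1}(n)=p_n$ be the $n$-th prime. For a natural number $p_0$, the Eratosthenes progression of base $p_0$ is the sequence defined by $p_{k+1}=\pi^{ -1}(p_k)$ for $k=0,1,2,\ldots$, and the Eratosthenes ray of base $p_0$ is the set $r_{p_0}=\{p_{k+1}: k=0,1,2,\ldots\}$ (it consists of primes and does not contain $p_0$ unless $p_0$ occurs later in the sequence). -}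

module Defs where

open import Data.Nat using (ℕ; zero; suc; _+_)
open import Data.Nat.Primality using (Prime; prime?)
open import Data.Product using (_×_; ∃-syntax)
open import Relation.Nullary.Decidable using (does)
open import Data.Bool using (if_then_else_)
open import Relation.Binary.PropositionalEquality using (_≡_)

π : ℕ → ℕ
π zero = 0
π (suc m) = (if does (prime? (suc m)) then 1 else 0) + π m

-- p is the n-th prime (p_1 = 2, p_2 = 3, ...), i.e. p = π⁻¹(n)
IsNthPrime : ℕ → ℕ → Set
IsNthPrime n p = Prime p × π p ≡ n

IsEratosthenesProgression : (ℕ → ℕ) → Set
IsEratosthenesProgression s = ∀ k → IsNthPrime (s k) (s (suc k))

InRay : (ℕ → ℕ) → ℕ → Set
InRay s x = ∃[ k ] x ≡ s (suc k)

-- Since π (p (k + 1)) = p k, a term of an Eratosthenes progression determines its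
-- predecessor, and, the n-th prime being unique, also its successor. So a value
-- shared by two progressions can be traced back until one base appears in the
-- other progression; if that is the larger base p″ 0, the ray of p″ 0 is a tail
-- of the ray of p′ 0, and otherwise the rays cannot meet at all, as the
-- progressions are increasing. Monotonicity of π carries p′ k < p″ k from k to k + 1.
module Submission where

open import Defs
open import Data.Bool using (true; false)
open import Data.Nat using (ℕ; zero; suc; _+_; _<_; _≤_; z≤n; s≤s; _≤′_; ≤′-refl; ≤′-step)
open import Data.Nat.Properties
open import Data.Nat.Primality using (Prime; prime?; ¬prime[0])
open import Data.Product using (_×_; _,_; proj₂; ∃-syntax)
open import Data.Sum using (_⊎_; inj₁; inj₂)
open import Relation.Binary using (tri<; tri≈; tri>)
open import Relation.Binary.PropositionalEquality
open import Relation.Nullary using (¬_; yes; no; contradiction)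
open import Relation.Nullary.Decidable using (does)

private
  variable
    m n p q : ℕ
    s t : ℕ → ℕ

π[1+n]≤1+π[n] : ∀ n → π (suc n) ≤ suc (π n)
π[1+n]≤1+π[n] n with does (prime? (suc n))
... | true  = ≤-refl
... | false = n≤1+n (π n)

π[n]≤π[1+n] : ∀ n → π n ≤ π (suc n)
π[n]≤π[1+n] n with does (prime? (suc n))
... | true  = n≤1+n (π n)
... | false = ≤-refl

π[1+n]≡1+π[n] : Prime (suc n) → π (suc n) ≡ suc (π n)
π[1+n]≡1+π[n] {n} prime[1+n] with prime? (suc n)
... | yes _ = refl
... | no ¬prime[1+n] = contradiction prime[1+n] ¬prime[1+n]

π[1+n]≤n : ∀ n → π (suc n) ≤ n
π[1+n]≤n zero    = z≤n
π[1+n]≤n (suc n) = ≤-trans (π[1+n]≤1+π[n] (suc n)) (s≤s (π[1+n]≤n n))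

π-mono-≤ : m ≤ n → π m ≤ π n
π-mono-≤ m≤n = go (≤⇒≤′ m≤n)
  where
  go : m ≤′ n → π m ≤ π n
  go ≤′-refl            = ≤-refl
  go (≤′-step {n} m≤′n) = ≤-trans (go m≤′n) (π[n]≤π[1+n] n)

π-cancel-< : π m < π n → m < n
π-cancel-< π[m]<π[n] = ≰⇒> λ n≤m → <⇒≱ π[m]<π[n] (π-mono-≤ n≤m)

π-mono-<-prime : Prime n → m < n → π m < π n
π-mono-<-prime {zero}  prime[0]   _           = contradiction prime[0] ¬prime[0]
π-mono-<-prime {suc n} prime[1+n] (s≤s m≤n) rewrite π[1+n]≡1+π[n] prime[1+n] = s≤s (π-mono-≤ m≤n)

nthPrime-unique : IsNthPrime n p → IsNthPrime n q → p ≡ q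
nthPrime-unique {p = p} {q = q} (prime[p] , refl) (prime[q] , π[q]≡π[p]) with <-cmp p q
... | tri< p<q _ _ = contradiction π[q]≡π[p] (>⇒≢ (π-mono-<-prime prime[q] p<q))
... | tri≈ _ p≡q _ = p≡q
... | tri> _ _ q<p = contradiction π[q]≡π[p] (<⇒≢ (π-mono-<-prime prime[p] q<p))

progression-< : IsEratosthenesProgression s → ∀ k → s k < s (suc k)
progression-< {s = s} E k with s (suc k) | E k
... | zero  | prime[0] , _    = contradiction prime[0] ¬prime[0]
... | suc m | _ , π[1+m]≡s[k] = subst (_< suc m) π[1+m]≡s[k] (s≤s (π[1+n]≤n m))

progression-mono-≤ : IsEratosthenesProgression s → m ≤ n → s m ≤ s n
progression-mono-≤ {s = s} E m≤n = go (≤⇒≤′ m≤n)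
  where
  go : m ≤′ n → s m ≤ s n
  go ≤′-refl            = ≤-refl
  go (≤′-step {n} m≤′n) = ≤-trans (go m≤′n) (<⇒≤ (progression-< E n))

progression-shift : IsEratosthenesProgression s → ∀ j → IsEratosthenesProgression (λ k → s (k + j))
progression-shift E j k = E (k + j)

progression-unique : IsEratosthenesProgression s → IsEratosthenesProgression t
  → s 0 ≡ t 0 → ∀ k → s k ≡ t k
progression-unique Es Et s₀≡t₀ zero    = s₀≡t₀
progression-unique Es Et s₀≡t₀ (suc k) =
  nthPrime-unique (subst (λ n → IsNthPrime n _) (progression-unique Es Et s₀≡t₀ k) (Es k)) (Et k)

progressions-meet-earlier : IsEratosthenesProgression s → IsEratosthenesProgression t
  → s (suc m) ≡ t (suc n) → s m ≡ t n
progressions-meet-earlier {m = m} {n = n} Es Et e =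
  trans (sym (proj₂ (Es m))) (trans (cong π e) (proj₂ (Et n)))

progressions-meet⇒base-on-other : IsEratosthenesProgression s → IsEratosthenesProgression t
  → s m ≡ t n → (∃[ j ] s 0 ≡ t j) ⊎ (∃[ j ] t 0 ≡ s j)
progressions-meet⇒base-on-other {m = zero}  {n = n}     Es Et e = inj₁ (n , e)
progressions-meet⇒base-on-other {m = suc m} {n = zero}  Es Et e = inj₂ (suc m , sym e)
progressions-meet⇒base-on-other {m = suc m} {n = suc n} Es Et e =
  progressions-meet⇒base-on-other Es Et (progressions-meet-earlier Es Et e)

ray-⊆ : IsEratosthenesProgression s → IsEratosthenesProgression t
  → InRay s (t 0) → ∀ x → InRay t x → InRay s x
ray-⊆ Es Et (j , t₀≡s[1+j]) x (k , refl) =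
  k + suc j , progression-unique Et (progression-shift Es (suc j)) t₀≡s[1+j] (suc k)

ray-disjoint : IsEratosthenesProgression s → IsEratosthenesProgression t
  → s 0 < t 0 → ¬ InRay s (t 0) → ∀ x → InRay t x → ¬ InRay s x
ray-disjoint {t = t} Es Et s₀<t₀ t₀∉ x (a , refl) (b , e)
  with progressions-meet⇒base-on-other Et Es e
... | inj₁ (zero  , t₀≡s₀)     = <-irrefl (sym t₀≡s₀) s₀<t₀
... | inj₁ (suc j , t₀≡s[1+j]) = t₀∉ (j , t₀≡s[1+j])
... | inj₂ (j     , s₀≡t[j])   =
  <⇒≱ s₀<t₀ (subst (t 0 ≤_) (sym s₀≡t[j]) (progression-mono-≤ Et z≤n))

progression-<-from-base : IsEratosthenesProgression s → IsEratosthenesProgression t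
  → s 0 < t 0 → ∀ k → s k < t k
progression-<-from-base Es Et s₀<t₀ zero    = s₀<t₀
progression-<-from-base Es Et s₀<t₀ (suc k) =
  π-cancel-< (subst₂ _<_ (sym (proj₂ (Es k))) (sym (proj₂ (Et k)))
    (progression-<-from-base Es Et s₀<t₀ k))

lemma2 : (p′ p″ : ℕ → ℕ) → IsEratosthenesProgression p′ → IsEratosthenesProgression p″
    → 1 ≤ p′ 0 → p′ 0 < p″ 0
    → (InRay p′ (p″ 0) → ∀ x → InRay p″ x → InRay p′ x)
      × (¬ InRay p′ (p″ 0) → (∀ x → InRay p″ x → ¬ InRay p′ x) × (∀ k → p′ k < p″ k))
lemma2 p′ p″ E′ E″ _ p′₀<p″₀ =
  ray-⊆ E′ E″ ,
  λ p″₀∉ → ray-disjoint E′ E″ p′₀<p″₀ p″₀∉ , progression-<-from-base E′ E″ p′₀<p″₀
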